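{- Let $\mathbf{A}$ be a bounded pointed lattice (with bottom $\bot$ and top $\top$) and let $\overline{\mathsf{1}}\in\mathbf{A}$ be such that $\mathsf{1}\nleq\overline{\mathsf{1}}$ and for each $a\in\mathbf{A}$ either $\mathsf{1}\leq a$ or $a\leq\overline{\mathsf{1}}$. Define $a\cdot b:=\bot$ if $a\ngeq\mathsf{1}$ and $b\ngeq\mathsf{1}$; $a\cdot b:=a$ if $a\ngeq\mathsf{1}$ and $b\geq\mathsf{1}$; $a\cdot b:=b$ if $a\geq\mathsf{1}$ and $b\ngeq\mathsf{1}$; $a\cdot b:=a\vee b$ if $a\geq\mathsf{1}$ and $b\geq\mathsf{1}$; and $a\rightarrow b:=\top$ if $a\ngeq\mathsf{1}$ and $a\leq b$; $a\rightarrow b:=\overline{\mathsf{1}}$ if $a\ngeq\mathsf{1}$ and $a\nleq b$; $a\rightarrow b:=b$ if $a\geq\mathsf{1}$ and $b\ngeq\mathsf{1}$; $a\rightarrow b:=b$ if $a\geq\mathsf{1}$, $b\geq\mathsf{1}$ and $a\leq b$; $a\rightarrow b:=b\wedge\overline{\mathsf{1}}$ if $a\geq\mathsf{1}$, $b\geq\mathsf{1}$ and $a\nleq b$. Then $\langle A;\wedge,\vee,\cdot,\mathsf{1},\rightarrow\rangle$ is a simple commutative residuated lattice whose pointed lattice reduct is $\mathbf{A}$.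
   Context: A pointed lattice is a lattice with a constant $\mathsf{1}$. A commutative residuated lattice is an algebra $\langle A;\wedge,\vee,\cdot,\mathsf{1},\rightarrow\rangle$ such that $\langle A;\wedge,\vee\rangle$ is a lattice, $\langle A;\cdot,\mathsf{1}\rangle$ is a commutative monoid, and $x\cdot y\leq z\iff y\leq x\rightarrow z$; it is simple if it has exactly two congruences. -}

module Defs where

open import Level using (Level; _⊔_; Setω)
open import Data.Product using (_×_; _,_)
open import Data.Sum using (_⊎_)
open import Relation.Nullary using (¬_; Dec; yes; no)
open import Relation.Binary using (Rel; IsEquivalence)
open import Relation.Binary.Lattice.Bundles using (BoundedLattice)
open import Algebra.Core using (Op₂)
open import Algebra.Lattice.Structures using (IsLattice)
open import Algebra.Structures using (IsCommutativeMonoid)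
open import Function.Bundles using (_⇔_)

-- The law of excluded middle (in its Dec form), at every universe level.
-- The paper's constructions and arguments are classical; we make this
-- explicit as a hypothesis.
LEM : Setω
LEM = ∀ {a} (P : Set a) → Dec P

-- Commutative residuated lattice ⟨A; ∧, ∨, ·, 1, →⟩ over a setoid (A, ≈).
-- The lattice order is x ≤ y  :⇔  x ∧ y ≈ x.
record IsCommResLattice {c ℓ} {A : Set c} (_≈_ : Rel A ℓ)
    (_∧_ _∨_ _·_ : Op₂ A) (𝟙 : A) (_⇒_ : Op₂ A) : Set (c ⊔ ℓ) where
  field
    isLattice           : IsLattice _≈_ _∨_ _∧_
    isCommutativeMonoid : IsCommutativeMonoid _≈_ _·_ 𝟙
    ⇒-cong              : ∀ {x x′ y y′} → x ≈ x′ → y ≈ y′ → (x ⇒ y) ≈ (x′ ⇒ y′)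
    residuated          : ∀ x y z →
                          (((x · y) ∧ z) ≈ (x · y)) ⇔ ((y ∧ (x ⇒ z)) ≈ y)

-- Congruences of an algebra ⟨A; ∧, ∨, ·, 1, →⟩ over the setoid (A, ≈):
-- equivalence relations containing ≈ and compatible with all operations
-- (compatibility with the constant 1 is automatic).
record IsCongruence {c ℓ ℓθ} {A : Set c} (_≈_ : Rel A ℓ)
    (_∧_ _∨_ _·_ : Op₂ A) (_⇒_ : Op₂ A) (θ : Rel A ℓθ) : Set (c ⊔ ℓ ⊔ ℓθ) where
  field
    isEquivalence : IsEquivalence θ
    ≈⊆θ           : ∀ {x y} → x ≈ y → θ x y
    ∧-compat      : ∀ {x x′ y y′} → θ x x′ → θ y y′ → θ (x ∧ y) (x′ ∧ y′)
    ∨-compat      : ∀ {x x′ y y′} → θ x x′ → θ y y′ → θ (x ∨ y) (x′ ∨ y′)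
    ·-compat      : ∀ {x x′ y y′} → θ x x′ → θ y y′ → θ (x · y) (x′ · y′)
    ⇒-compat      : ∀ {x x′ y y′} → θ x x′ → θ y y′ → θ (x ⇒ y) (x′ ⇒ y′)

record IsSimple {c ℓ} {A : Set c} (_≈_ : Rel A ℓ)
    (_∧_ _∨_ _·_ : Op₂ A) (_⇒_ : Op₂ A) : Setω where
  field
    Δ≢∇        : ¬ (∀ x y → x ≈ y)
    only-Δ-or-∇ : ∀ {ℓθ} (θ : Rel A ℓθ) → IsCongruence _≈_ _∧_ _∨_ _·_ _⇒_ θ →
                  (∀ x y → θ x y → x ≈ y) ⊎ (∀ x y → θ x y)

module Construction {c ℓ₁ ℓ₂} (A : BoundedLattice c ℓ₁ ℓ₂) (lem : LEM) where
  open BoundedLattice A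

  module _ (𝟙 𝟙̄ : Carrier) where

    _·_ : Op₂ Carrier
    a · b with lem (𝟙 ≤ a) | lem (𝟙 ≤ b)
    ... | no  _ | no  _ = ⊥
    ... | no  _ | yes _ = a
    ... | yes _ | no  _ = b
    ... | yes _ | yes _ = a ∨ b

    _⇒_ : Op₂ Carrier
    a ⇒ b with lem (𝟙 ≤ a)
    ... | no _ with lem (a ≤ b)
    ...   | yes _ = ⊤
    ...   | no  _ = 𝟙̄
    a ⇒ b | yes _ with lem (𝟙 ≤ b)
    ...   | no _ = b
    ...   | yes _ with lem (a ≤ b)
    ...     | yes _ = b
    ...     | no  _ = b ∧ 𝟙̄

record IsSimpleCommResLattice {c ℓ} {A : Set c} (_≈_ : Rel A ℓ)
    (_∧_ _∨_ _·_ : Op₂ A) (𝟙 : A) (_⇒_ : Op₂ A) : Setω where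
  field
    isCommResLattice : IsCommResLattice _≈_ _∧_ _∨_ _·_ 𝟙 _⇒_
    isSimple         : IsSimple _≈_ _∧_ _∨_ _·_ _⇒_

{-# OPTIONS --safe #-}
-- Every element lies either above 𝟙 or below 𝟙̄, and the two classes are
-- disjoint. On the upper class · is ∨, the lower class is an ideal on which
-- · is constantly ⊥, and upper elements act trivially on lower ones; the
-- monoid laws and residuation are then checked class by class.
-- A congruence identifying distinct a, b identifies a ∧ b with a ∨ b, hence
-- (a ∨ b) → (a ∧ b) with (a ∨ b) → (a ∨ b); in every case this relates an
-- element below 𝟙̄ with one above 𝟙. Squaring both and applying (_→ ⊥) then
-- relates ⊤ with ⊥, so every x ≈ x ∧ ⊤ is related with x ∧ ⊥ ≈ ⊥.
module Submission where

open import Defs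
open import Data.Sum using (_⊎_; inj₁; inj₂)
open import Data.Product using (_,_)
open import Function.Base using (_∘_)
open import Relation.Nullary using (¬_; yes; no; contradiction)
open import Relation.Nullary.Decidable using (decidable-stable)
open import Relation.Binary using (Rel; IsEquivalence)
open import Relation.Binary.Lattice.Bundles using (MeetSemilattice; BoundedLattice)
open import Relation.Binary.PropositionalEquality using (_≡_; subst₂)
open import Function.Bundles using (_⇔_; mk⇔; Equivalence)
open import Function.Construct.Identity using (⇔-id)
open import Function.Construct.Composition using (_⇔-∘_)
open import Function.Construct.Symmetry using (⇔-sym)
import Relation.Binary.Lattice.Properties.MeetSemilattice as MeetProperties
import Relation.Binary.Lattice.Properties.JoinSemilattice as JoinProperties
import Relation.Binary.Lattice.Properties.Lattice as LatticeProperties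
import Relation.Binary.Lattice.Properties.BoundedLattice as BoundedLatticeProperties

module _ {c ℓ₁ ℓ₂} (M : MeetSemilattice c ℓ₁ ℓ₂) where
  open MeetSemilattice M
  open MeetProperties M using (y≤x⇒x∧y≈y; ∧-comm)

  ≤⇔∧≈ : ∀ {x y} → x ≤ y ⇔ (x ∧ y ≈ x)
  ≤⇔∧≈ {x} {y} = mk⇔
    (λ x≤y → Eq.trans (∧-comm x y) (y≤x⇒x∧y≈y x≤y))
    (λ x∧y≈x → trans (reflexive (Eq.sym x∧y≈x)) (x∧y≤y x y))

module ConstructionProperties {c ℓ₁ ℓ₂} (A : BoundedLattice c ℓ₁ ℓ₂) (lem : LEM)
    (𝟙 𝟙̄ : BoundedLattice.Carrier A) where
  open BoundedLattice A
  open LatticeProperties lattice using (isAlgLattice; collapse₂)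
  open JoinProperties joinSemilattice using (∨-cong; ∨-comm; ∨-assoc; ∨-idempotent; x≤y⇒x∨y≈y)
  open MeetProperties meetSemilattice using (∧-cong; ∧-idempotent)
  open BoundedLatticeProperties A using (∧-zeroʳ)

  infixl 7 _·_
  infixr 5 _⇒_

  _·_ : Carrier → Carrier → Carrier
  _·_ = Construction._·_ A lem 𝟙 𝟙̄

  _⇒_ : Carrier → Carrier → Carrier
  _⇒_ = Construction._⇒_ A lem 𝟙 𝟙̄

  Up Down : Carrier → Set ℓ₂
  Up x = 𝟙 ≤ x
  Down x = ¬ 𝟙 ≤ x

  up-or-down : ∀ x → Up x ⊎ Down x
  up-or-down x with lem (Up x)
  ... | yes up = inj₁ up
  ... | no down = inj₂ down

  ≤-cong : ∀ {x x′ y y′} → x ≈ x′ → y ≈ y′ → x ≤ y → x′ ≤ y′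
  ≤-cong x≈x′ y≈y′ x≤y = ≤-respʳ-≈ y≈y′ (≤-respˡ-≈ x≈x′ x≤y)

  up-resp-≈ : ∀ {x y} → x ≈ y → Up x → Up y
  up-resp-≈ = ≤-respʳ-≈

  down-resp-≈ : ∀ {x y} → x ≈ y → Down x → Down y
  down-resp-≈ x≈y down-x up-y = down-x (≤-respʳ-≈ (Eq.sym x≈y) up-y)

  up-∨ : ∀ {x} y → Up x → Up (x ∨ y)
  up-∨ {x} y up-x = trans up-x (x≤x∨y x y)

  ·-down-down : ∀ {a b} → Down a → Down b → a · b ≡ ⊥
  ·-down-down {a} {b} da db with lem (Up a) | lem (Up b)
  ... | yes ua | _     = contradiction ua da
  ... | no _   | yes ub = contradiction ub db
  ... | no _   | no _  = _≡_.refl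

  ·-down-up : ∀ {a b} → Down a → Up b → a · b ≡ a
  ·-down-up {a} {b} da ub with lem (Up a) | lem (Up b)
  ... | yes ua | _     = contradiction ua da
  ... | no _   | no db = contradiction ub db
  ... | no _   | yes _ = _≡_.refl

  ·-up-down : ∀ {a b} → Up a → Down b → a · b ≡ b
  ·-up-down {a} {b} ua db with lem (Up a) | lem (Up b)
  ... | no da  | _      = contradiction ua da
  ... | yes _  | yes ub = contradiction ub db
  ... | yes _  | no _   = _≡_.refl

  ·-up-up : ∀ {a b} → Up a → Up b → a · b ≡ a ∨ b
  ·-up-up {a} {b} ua ub with lem (Up a) | lem (Up b)
  ... | no da  | _     = contradiction ua da
  ... | yes _  | no db = contradiction ub db
  ... | yes _  | yes _ = _≡_.refl

  ⇒-down-≤ : ∀ {a b} → Down a → a ≤ b → a ⇒ b ≡ ⊤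
  ⇒-down-≤ {a} {b} da a≤b with lem (Up a)
  ... | yes ua = contradiction ua da
  ... | no _ with lem (a ≤ b)
  ...   | yes _ = _≡_.refl
  ...   | no a≰b = contradiction a≤b a≰b

  ⇒-down-≰ : ∀ {a b} → Down a → ¬ a ≤ b → a ⇒ b ≡ 𝟙̄
  ⇒-down-≰ {a} {b} da a≰b with lem (Up a)
  ... | yes ua = contradiction ua da
  ... | no _ with lem (a ≤ b)
  ...   | yes a≤b = contradiction a≤b a≰b
  ...   | no _ = _≡_.refl

  ⇒-up-down : ∀ {a b} → Up a → Down b → a ⇒ b ≡ b
  ⇒-up-down {a} {b} ua db with lem (Up a)
  ... | no da = contradiction ua da
  ... | yes _ with lem (Up b)
  ...   | yes ub = contradiction ub db
  ...   | no _ = _≡_.refl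

  ⇒-up-up-≤ : ∀ {a b} → Up a → Up b → a ≤ b → a ⇒ b ≡ b
  ⇒-up-up-≤ {a} {b} ua ub a≤b with lem (Up a)
  ... | no da = contradiction ua da
  ... | yes _ with lem (Up b)
  ...   | no db = contradiction ub db
  ...   | yes _ with lem (a ≤ b)
  ...     | yes _ = _≡_.refl
  ...     | no a≰b = contradiction a≤b a≰b

  ⇒-up-up-≰ : ∀ {a b} → Up a → Up b → ¬ a ≤ b → a ⇒ b ≡ b ∧ 𝟙̄
  ⇒-up-up-≰ {a} {b} ua ub a≰b with lem (Up a)
  ... | no da = contradiction ua da
  ... | yes _ with lem (Up b)
  ...   | no db = contradiction ub db
  ...   | yes _ with lem (a ≤ b)
  ...     | yes a≤b = contradiction a≤b a≰b
  ...     | no _ = _≡_.refl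

  ·-cong : ∀ {x x′ y y′} → x ≈ x′ → y ≈ y′ → x · y ≈ x′ · y′
  ·-cong {x} {x′} {y} {y′} x≈x′ y≈y′ with up-or-down x | up-or-down y
  ... | inj₁ ux | inj₁ uy
    rewrite ·-up-up ux uy | ·-up-up (up-resp-≈ x≈x′ ux) (up-resp-≈ y≈y′ uy) = ∨-cong x≈x′ y≈y′
  ... | inj₁ ux | inj₂ dy
    rewrite ·-up-down ux dy | ·-up-down (up-resp-≈ x≈x′ ux) (down-resp-≈ y≈y′ dy) = y≈y′
  ... | inj₂ dx | inj₁ uy
    rewrite ·-down-up dx uy | ·-down-up (down-resp-≈ x≈x′ dx) (up-resp-≈ y≈y′ uy) = x≈x′
  ... | inj₂ dx | inj₂ dy
    rewrite ·-down-down dx dy | ·-down-down (down-resp-≈ x≈x′ dx) (down-resp-≈ y≈y′ dy) = Eq.refl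

  ·-comm : ∀ x y → x · y ≈ y · x
  ·-comm x y with up-or-down x | up-or-down y
  ... | inj₁ ux | inj₁ uy rewrite ·-up-up ux uy | ·-up-up uy ux = ∨-comm x y
  ... | inj₁ ux | inj₂ dy rewrite ·-up-down ux dy | ·-down-up dy ux = Eq.refl
  ... | inj₂ dx | inj₁ uy rewrite ·-down-up dx uy | ·-up-down uy dx = Eq.refl
  ... | inj₂ dx | inj₂ dy rewrite ·-down-down dx dy | ·-down-down dy dx = Eq.refl

  ·-identityˡ : ∀ x → 𝟙 · x ≈ x
  ·-identityˡ x with up-or-down x
  ... | inj₁ ux rewrite ·-up-up refl ux = x≤y⇒x∨y≈y ux
  ... | inj₂ dx rewrite ·-up-down refl dx = Eq.refl

  ·-identityʳ : ∀ x → x · 𝟙 ≈ x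
  ·-identityʳ x = Eq.trans (·-comm x 𝟙) (·-identityˡ x)

  ⇒-cong : ∀ {x x′ y y′} → x ≈ x′ → y ≈ y′ → x ⇒ y ≈ x′ ⇒ y′
  ⇒-cong {x} {x′} {y} {y′} x≈x′ y≈y′ with up-or-down x | up-or-down y | lem (x ≤ y)
  ... | inj₂ dx | _ | yes x≤y
    rewrite ⇒-down-≤ dx x≤y
          | ⇒-down-≤ (down-resp-≈ x≈x′ dx) (≤-cong x≈x′ y≈y′ x≤y) = Eq.refl
  ... | inj₂ dx | _ | no x≰y
    rewrite ⇒-down-≰ dx x≰y
          | ⇒-down-≰ (down-resp-≈ x≈x′ dx) (x≰y ∘ ≤-cong (Eq.sym x≈x′) (Eq.sym y≈y′)) = Eq.refl
  ... | inj₁ ux | inj₂ dy | _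
    rewrite ⇒-up-down ux dy | ⇒-up-down (up-resp-≈ x≈x′ ux) (down-resp-≈ y≈y′ dy) = y≈y′
  ... | inj₁ ux | inj₁ uy | yes x≤y
    rewrite ⇒-up-up-≤ ux uy x≤y
          | ⇒-up-up-≤ (up-resp-≈ x≈x′ ux) (up-resp-≈ y≈y′ uy) (≤-cong x≈x′ y≈y′ x≤y) = y≈y′
  ... | inj₁ ux | inj₁ uy | no x≰y
    rewrite ⇒-up-up-≰ ux uy x≰y
          | ⇒-up-up-≰ (up-resp-≈ x≈x′ ux) (up-resp-≈ y≈y′ uy)
                      (x≰y ∘ ≤-cong (Eq.sym x≈x′) (Eq.sym y≈y′)) = ∧-cong y≈y′ Eq.refl

  module _ (𝟙≰𝟙̄ : ¬ 𝟙 ≤ 𝟙̄) (dichotomy : ∀ a → 𝟙 ≤ a ⊎ a ≤ 𝟙̄) where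

    down⇒≤𝟙̄ : ∀ {x} → Down x → x ≤ 𝟙̄
    down⇒≤𝟙̄ {x} dx with dichotomy x
    ... | inj₁ ux = contradiction ux dx
    ... | inj₂ x≤𝟙̄ = x≤𝟙̄

    ≤𝟙̄⇒down : ∀ {x} → x ≤ 𝟙̄ → Down x
    ≤𝟙̄⇒down x≤𝟙̄ ux = 𝟙≰𝟙̄ (trans ux x≤𝟙̄)

    ⊥-down : Down ⊥
    ⊥-down = ≤𝟙̄⇒down (minimum 𝟙̄)

    ·-assoc : ∀ x y z → (x · y) · z ≈ x · (y · z)
    ·-assoc x y z with up-or-down x | up-or-down y | up-or-down z
    ... | inj₁ ux | inj₁ uy | inj₁ uz
      rewrite ·-up-up ux uy | ·-up-up (up-∨ y ux) uz | ·-up-up uy uz | ·-up-up ux (up-∨ z uy)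
      = ∨-assoc x y z
    ... | inj₁ ux | inj₁ uy | inj₂ dz
      rewrite ·-up-up ux uy | ·-up-down (up-∨ y ux) dz | ·-up-down uy dz | ·-up-down ux dz
      = Eq.refl
    ... | inj₁ ux | inj₂ dy | inj₁ uz
      rewrite ·-up-down ux dy | ·-down-up dy uz | ·-up-down ux dy = Eq.refl
    ... | inj₁ ux | inj₂ dy | inj₂ dz
      rewrite ·-up-down ux dy | ·-down-down dy dz | ·-up-down ux ⊥-down = Eq.refl
    ... | inj₂ dx | inj₁ uy | inj₁ uz
      rewrite ·-down-up dx uy | ·-down-up dx uz | ·-up-up uy uz | ·-down-up dx (up-∨ z uy)
      = Eq.refl
    ... | inj₂ dx | inj₁ uy | inj₂ dz
      rewrite ·-down-up dx uy | ·-down-down dx dz | ·-up-down uy dz | ·-down-down dx dz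
      = Eq.refl
    ... | inj₂ dx | inj₂ dy | inj₁ uz
      rewrite ·-down-down dx dy | ·-down-up ⊥-down uz | ·-down-up dy uz | ·-down-down dx dy
      = Eq.refl
    ... | inj₂ dx | inj₂ dy | inj₂ dz
      rewrite ·-down-down dx dy | ·-down-down ⊥-down dz | ·-down-down dy dz
            | ·-down-down dx ⊥-down
      = Eq.refl

    residuation-down : ∀ {x} → Down x → ∀ y z → x · y ≤ z ⇔ y ≤ x ⇒ z
    residuation-down {x} dx y z with lem (x ≤ z) | up-or-down y
    ... | yes x≤z | inj₁ uy rewrite ⇒-down-≤ dx x≤z | ·-down-up dx uy =
      mk⇔ (λ _ → maximum y) (λ _ → x≤z)
    ... | yes x≤z | inj₂ dy rewrite ⇒-down-≤ dx x≤z | ·-down-down dx dy =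
      mk⇔ (λ _ → maximum y) (λ _ → minimum z)
    ... | no x≰z | inj₁ uy rewrite ⇒-down-≰ dx x≰z | ·-down-up dx uy =
      mk⇔ (λ x≤z → contradiction x≤z x≰z) (λ y≤𝟙̄ → contradiction uy (≤𝟙̄⇒down y≤𝟙̄))
    ... | no x≰z | inj₂ dy rewrite ⇒-down-≰ dx x≰z | ·-down-down dx dy =
      mk⇔ (λ _ → down⇒≤𝟙̄ dy) (λ _ → minimum z)

    residuation-up : ∀ {x} → Up x → ∀ y z → x · y ≤ z ⇔ y ≤ x ⇒ z
    residuation-up {x} ux y z with up-or-down z | up-or-down y | lem (x ≤ z)
    ... | inj₂ dz | inj₁ uy | _ rewrite ⇒-up-down ux dz | ·-up-up ux uy =
      mk⇔ (λ x∨y≤z → contradiction (trans (up-∨ y ux) x∨y≤z) dz)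
          (λ y≤z → contradiction (trans uy y≤z) dz)
    ... | inj₂ dz | inj₂ dy | _ rewrite ⇒-up-down ux dz | ·-up-down ux dy = ⇔-id _
    ... | inj₁ uz | inj₁ uy | yes x≤z rewrite ⇒-up-up-≤ ux uz x≤z | ·-up-up ux uy =
      mk⇔ (trans (y≤x∨y x y)) (∨-least x≤z)
    ... | inj₁ uz | inj₂ dy | yes x≤z rewrite ⇒-up-up-≤ ux uz x≤z | ·-up-down ux dy = ⇔-id _
    ... | inj₁ uz | inj₁ uy | no x≰z rewrite ⇒-up-up-≰ ux uz x≰z | ·-up-up ux uy =
      mk⇔ (λ x∨y≤z → contradiction (trans (x≤x∨y x y) x∨y≤z) x≰z)
          (λ y≤z∧𝟙̄ → contradiction uy (≤𝟙̄⇒down (trans y≤z∧𝟙̄ (x∧y≤y z 𝟙̄))))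
    ... | inj₁ uz | inj₂ dy | no x≰z rewrite ⇒-up-up-≰ ux uz x≰z | ·-up-down ux dy =
      mk⇔ (λ y≤z → ∧-greatest y≤z (down⇒≤𝟙̄ dy)) (λ y≤z∧𝟙̄ → trans y≤z∧𝟙̄ (x∧y≤x z 𝟙̄))

    residuation : ∀ x y z → x · y ≤ z ⇔ y ≤ x ⇒ z
    residuation x y z with up-or-down x
    ... | inj₁ ux = residuation-up ux y z
    ... | inj₂ dx = residuation-down dx y z

    module _ {ℓθ} {θ : Rel Carrier ℓθ} (θ-congruence : IsCongruence _≈_ _∧_ _∨_ _·_ _⇒_ θ) where
      open IsCongruence θ-congruence using (≈⊆θ; ∧-compat; ∨-compat; ·-compat; ⇒-compat)
      open IsEquivalence (IsCongruence.isEquivalence θ-congruence) using ()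
        renaming (refl to θ-refl; sym to θ-sym; trans to θ-trans)

      down-θ-up⇒⊤-θ-⊥ : ∀ {d u} → Down d → Up u → θ d u → θ ⊤ ⊥
      down-θ-up⇒⊤-θ-⊥ {u = u} dd uu dθu =
        subst₂ θ (⇒-down-≤ ⊥-down refl) (⇒-up-down (up-∨ u uu) ⊥-down) (⇒-compat ⊥θu∨u θ-refl)
        where
        ⊥θu∨u : θ ⊥ (u ∨ u)
        ⊥θu∨u = subst₂ θ (·-down-down dd dd) (·-up-up uu uu) (·-compat dθu dθu)

      ∧-θ-∨ : ∀ {a b} → θ a b → θ (a ∧ b) (a ∨ b)
      ∧-θ-∨ {b = b} aθb = θ-trans a∧bθb (θ-sym a∨bθb)
        where
        a∧bθb = θ-trans (∧-compat aθb θ-refl) (≈⊆θ (∧-idempotent b))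
        a∨bθb = θ-trans (∨-compat aθb θ-refl) (≈⊆θ (∨-idempotent b))

      distinct-θ⇒⊤-θ-⊥ : ∀ {a b} → θ a b → ¬ a ≈ b → θ ⊤ ⊥
      distinct-θ⇒⊤-θ-⊥ {a} {b} aθb a≉b = by-position (up-or-down (a ∨ b)) (up-or-down (a ∧ b))
        where
        M≰m : ¬ a ∨ b ≤ a ∧ b
        M≰m = a≉b ∘ collapse₂

        M⇒m-θ-M⇒M : θ (a ∨ b ⇒ a ∧ b) (a ∨ b ⇒ a ∨ b)
        M⇒m-θ-M⇒M = ⇒-compat θ-refl (∧-θ-∨ aθb)

        by-position : Up (a ∨ b) ⊎ Down (a ∨ b) → Up (a ∧ b) ⊎ Down (a ∧ b) → θ ⊤ ⊥
        by-position (inj₂ dM) _ = down-θ-up⇒⊤-θ-⊥ (≤𝟙̄⇒down refl) (maximum 𝟙)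
          (subst₂ θ (⇒-down-≰ dM M≰m) (⇒-down-≤ dM refl) M⇒m-θ-M⇒M)
        by-position (inj₁ uM) (inj₂ dm) = down-θ-up⇒⊤-θ-⊥ dm uM (∧-θ-∨ aθb)
        by-position (inj₁ uM) (inj₁ um) = down-θ-up⇒⊤-θ-⊥ (≤𝟙̄⇒down (x∧y≤y (a ∧ b) 𝟙̄)) uM
          (subst₂ θ (⇒-up-up-≰ uM um M≰m) (⇒-up-up-≤ uM uM refl) M⇒m-θ-M⇒M)

      ⊤-θ-⊥⇒θ-total : θ ⊤ ⊥ → ∀ x y → θ x y
      ⊤-θ-⊥⇒θ-total ⊤θ⊥ x y = θ-trans (θ-⊥ x) (θ-sym (θ-⊥ y))
        where
        θ-⊥ : ∀ x → θ x ⊥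
        θ-⊥ x = θ-trans (≈⊆θ (Eq.sym (Equivalence.to (≤⇔∧≈ meetSemilattice) (maximum x))))
                        (θ-trans (∧-compat θ-refl ⊤θ⊥) (≈⊆θ (∧-zeroʳ x)))

      Δ-or-∇ : (∀ x y → θ x y → x ≈ y) ⊎ (∀ x y → θ x y)
      Δ-or-∇ with lem (θ ⊤ ⊥)
      ... | yes ⊤θ⊥ = inj₂ (⊤-θ-⊥⇒θ-total ⊤θ⊥)
      ... | no ¬⊤θ⊥ = inj₁ λ x y xθy →
        decidable-stable (lem (x ≈ y)) (¬⊤θ⊥ ∘ distinct-θ⇒⊤-θ-⊥ xθy)

    isSimpleCommResLattice : IsSimpleCommResLattice _≈_ _∧_ _∨_ _·_ 𝟙 _⇒_
    isSimpleCommResLattice = record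
      { isCommResLattice = record
        { isLattice           = isAlgLattice
        ; isCommutativeMonoid = record
          { isMonoid = record
            { isSemigroup = record
              { isMagma = record { isEquivalence = isEquivalence ; ∙-cong = ·-cong }
              ; assoc   = ·-assoc
              }
            ; identity = ·-identityˡ , ·-identityʳ
            }
          ; comm = ·-comm
          }
        ; ⇒-cong     = ⇒-cong
        ; residuated = λ x y z →
            ≤⇔∧≈ meetSemilattice ⇔-∘ (residuation x y z ⇔-∘ ⇔-sym (≤⇔∧≈ meetSemilattice))
        }
      ; isSimple = record
        { Δ≢∇         = λ all-equal → 𝟙≰𝟙̄ (reflexive (all-equal 𝟙 𝟙̄))
        ; only-Δ-or-∇ = λ _ θ-congruence → Δ-or-∇ θ-congruence
        }
      }

lemma3p2 : ∀ {c ℓ₁ ℓ₂} (A : BoundedLattice c ℓ₁ ℓ₂) (lem : LEM)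
             (𝟙 𝟙̄ : BoundedLattice.Carrier A) →
             ¬ (BoundedLattice._≤_ A 𝟙 𝟙̄) →
             (∀ a → BoundedLattice._≤_ A 𝟙 a ⊎ BoundedLattice._≤_ A a 𝟙̄) →
             IsSimpleCommResLattice (BoundedLattice._≈_ A) (BoundedLattice._∧_ A)
               (BoundedLattice._∨_ A) (Construction._·_ A lem 𝟙 𝟙̄) 𝟙
               (Construction._⇒_ A lem 𝟙 𝟙̄)
lemma3p2 A lem 𝟙 𝟙̄ = ConstructionProperties.isSimpleCommResLattice A lem 𝟙 𝟙̄
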